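{- Let $t$ be a closed term. If $\Phi$ is a derivation in the CbN type system of $\vdash^{(m,e)} t : L$ (empty type context, $L$ a linear type), then there is $s$ and an evaluation sequence $d\colon t\to_{\mathrm{cbn}}^{*} s$ with $\mathrm{normal}(s)$, $|d|_m\leq m$ and $|d|_e\leq e$. Moreover, if $\Phi$ is tight then $|d|_m = m$ and $|d|_e=e$.
   Context: Terms: $t,s ::= x \mid \lambda x.t \mid t\,s \mid t[x\leftarrow s]$, where $t[x\leftarrow s]$ (explicit substitution) binds $x$ in $t$. $\mathrm{fv}(t[x\leftarrow s])=(\mathrm{fv}(t)\setminus\{x\})\cup\mathrm{fv}(s)$; closed means no free variables; terms up to $\alpha$-equivalence. Contexts: substitution contexts $S ::= \langle\cdot\rangle \mid S[x\leftarrow t]$; CbN contexts $C ::= \langle\cdot\rangle \mid C\,t \mid C[x\leftarrow t]$; $C\langle t\rangle$ is plugging (may capture), $C\langle\langle t\rangle\rangle$ plugging where $C$ does not capture free variables of $t$. Root steps: $S\langle\lambda x.t\rangle s\mapsto_m S\langle t[x\leftarrow s]\rangle$ (variables bound by $S$ disjoint from $\mathrm{fv}(s)$); $C\langle\langle x\rangle\rangle[x\leftarrow t]\mapsto_e C\langle\langle t\rangle\rangle[x\leftarrow t]$. $\to_{m,\mathrm{cbn}}$ (resp. $\to_{e,\mathrm{cbn}}$) relates $C\langle t'\rangle$ to $C\langle s'\rangle$ for any CbN context $C$ when $t'\mapsto_m s'$ (resp. $\mapsto_e$); $\to_{\mathrm{cbn}}$ is their union. $|d|_m$, $|d|_e$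 count multiplicative and exponential steps of $d$. $\mathrm{normal}$: least predicate with $\mathrm{normal}(\lambda x.t)$ and $\mathrm{normal}(t)\Rightarrow\mathrm{normal}(t[x\leftarrow s])$. CbN types: linear types $L ::= \mathsf{normal}\mid M\to L$; multi types $M ::= [L_i]_{i\in J}$ finite multisets, $\mathbf 0$ the empty multiset, $\uplus$ union. Type contexts $\Gamma$ map variables to multi types, all but finitely many to $\mathbf 0$; $\mathrm{dom}(\Gamma)=\{x\mid\Gamma(x)\neq\mathbf 0\}$; empty if domain empty; $\uplus$ pointwise; $\Gamma,x:M$ means $\Gamma\uplus(x\mapsto M)$ with $x\notin\mathrm{dom}(\Gamma)$; $\Gamma\setminus\!\!\setminus x$ is $\Gamma$ with $x$ mapped to $\mathbf 0$. Rules: (ax) $x:[L]\vdash^{(0,1)} x:L$; (normal) $\vdash^{(0,0)}\lambda x.t:\mathsf{normal}$; (fun) from $\Gamma\vdash^{(m,e)} t:L$ infer $\Gamma\setminus\!\!\setminus x\vdash^{(m,e)}\lambda x.t:\Gamma(x)\to L$; (many) from $\Pi_i\vdash^{(m_i,e_i)} t:L_i$ for $i\in J$ ($J$ finite, possibly empty) infer $\biguplus_i\Pi_i\vdash^{(\sum m_i,\sum e_i)} t:[L_i]_{i\in J}$; (app) from $\Gamma\vdash^{(m,e)} t:M\to L$ and $\Pi\vdash^{(m',e')} s:M$ infer $\Gamma\uplus\Pi\vdash^{(m+m'+1,e+e')} t\,s:L$; (ES) from $\Gamma,x:M\vdash^{(m,e)} t:L$ and $\Pi\vdash^{(m',e')}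 s:M$ infer $\Gamma\uplus\Pi\vdash^{(m+m',e+e')} t[x\leftarrow s]:L$. A derivation of $\Gamma\vdash^{(m,e)} t:L$ is tight if $L=\mathsf{normal}$ and $\Gamma$ is empty. -}

module Defs where

open import Data.Nat using (ℕ; zero; suc; _+_)
open import Data.Fin using (Fin; zero; suc)
open import Data.List using (List; []; _∷_; _++_)
open import Data.Vec using (Vec; []; _∷_; replicate; zipWith)
open import Function using (_∘_; id)

-- Terms (de Bruijn, intrinsically scoped: Term n has free variables
-- among Fin n; α-equivalence is thus syntactic equality).
-- esub t s  represents  t[x←s], binding index 0 in t.

data Term (n : ℕ) : Set where
  var  : Fin n → Term n
  lam  : Term (suc n) → Term n
  app  : Term n → Term n → Term n
  esub : Term (suc n) → Term n → Term n

ext : ∀ {n m} → (Fin n → Fin m) → Fin (suc n) → Fin (suc m)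
ext ρ zero    = zero
ext ρ (suc i) = suc (ρ i)

rename : ∀ {n m} → (Fin n → Fin m) → Term n → Term m
rename ρ (var i)    = var (ρ i)
rename ρ (lam t)    = lam (rename (ext ρ) t)
rename ρ (app t s)  = app (rename ρ t) (rename ρ s)
rename ρ (esub t s) = esub (rename (ext ρ) t) (rename ρ s)

-- Substitution contexts S ::= ⟨·⟩ | S[x←t]
-- SCtx n k : outer scope n, hole scope k.

data SCtx (n : ℕ) : ℕ → Set where
  hole : SCtx n n
  esL  : ∀ {k} → SCtx (suc n) k → Term n → SCtx n k

plugS : ∀ {n k} → SCtx n k → Term k → Term n
plugS hole       t = t
plugS (esL S u)  t = esub (plugS S t) u

-- weakening of outer variables into the hole scope (no capture)
wkS : ∀ {n k} → SCtx n k → Fin n → Fin k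
wkS hole      = id
wkS (esL S u) = wkS S ∘ suc

data Ctx (n : ℕ) : ℕ → Set where
  hole : Ctx n n
  appL : ∀ {k} → Ctx n k → Term n → Ctx n k
  esL  : ∀ {k} → Ctx (suc n) k → Term n → Ctx n k

-- plugging, possibly capturing
plug : ∀ {n k} → Ctx n k → Term k → Term n
plug hole       t = t
plug (appL C u) t = app (plug C t) u
plug (esL C u)  t = esub (plug C t) u

-- weakening of outer variables into the hole scope (plugging C⟨⟨·⟩⟩)
wkC : ∀ {n k} → Ctx n k → Fin n → Fin k
wkC hole       = id
wkC (appL C u) = wkC C
wkC (esL C u)  = wkC C ∘ suc

-- S⟨λx.t⟩ s ↦m S⟨t[x←s]⟩
data _↦m_ {n : ℕ} : Term n → Term n → Set where
  rule-m : ∀ {k} (S : SCtx n k) (t : Term (suc k)) (s : Term n) →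
           app (plugS S (lam t)) s ↦m plugS S (esub t (rename (wkS S) s))

-- C⟨⟨x⟩⟩[x←t] ↦e C⟨⟨t⟩⟩[x←t]
data _↦e_ {n : ℕ} : Term n → Term n → Set where
  rule-e : ∀ {k} (C : Ctx (suc n) k) (t : Term n) →
           esub (plug C (var (wkC C zero))) t ↦e
           esub (plug C (rename (wkC C ∘ suc) t)) t

data _⟶cbn_ {n : ℕ} : Term n → Term n → Set where
  m-step : ∀ {k} (C : Ctx n k) {t s : Term k} → t ↦m s → plug C t ⟶cbn plug C s
  e-step : ∀ {k} (C : Ctx n k) {t s : Term k} → t ↦e s → plug C t ⟶cbn plug C s

data _⟶*_ {n : ℕ} : Term n → Term n → Set where
  done : ∀ {t} → t ⟶* t
  _∷_  : ∀ {t u s} → t ⟶cbn u → u ⟶* s → t ⟶* s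

∣_∣m : ∀ {n} {t s : Term n} → t ⟶* s → ℕ
∣ done ∣m             = 0
∣ m-step _ _ ∷ d ∣m   = suc ∣ d ∣m
∣ e-step _ _ ∷ d ∣m   = ∣ d ∣m

∣_∣e : ∀ {n} {t s : Term n} → t ⟶* s → ℕ
∣ done ∣e             = 0
∣ m-step _ _ ∷ d ∣e   = ∣ d ∣e
∣ e-step _ _ ∷ d ∣e   = suc ∣ d ∣e

data Normal {n : ℕ} : Term n → Set where
  normal-lam : ∀ {t} → Normal (lam t)
  normal-es  : ∀ {t s} → Normal t → Normal (esub t s)

-- CbN types.  Multisets are represented by lists, considered up to the
-- (nested) multiset equivalence _≈M_ defined below.

data LType : Set where
  normal : LType
  _⇒_    : List LType → LType → LType

MType : Set
MType = List LType

mutual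
  data _≈L_ : LType → LType → Set where
    normal≈ : normal ≈L normal
    ⇒≈      : ∀ {M M' L L'} → M ≈M M' → L ≈L L' → (M ⇒ L) ≈L (M' ⇒ L')

  data _≈M_ : MType → MType → Set where
    []≈   : [] ≈M []
    ∷≈    : ∀ {x y xs ys} → x ≈L y → xs ≈M ys → (x ∷ xs) ≈M (y ∷ ys)
    swap≈ : ∀ {x y xs} → (x ∷ y ∷ xs) ≈M (y ∷ x ∷ xs)
    trans≈ : ∀ {xs ys zs} → xs ≈M ys → ys ≈M zs → xs ≈M zs

-- type contexts over scope n (entry i is the multi type of variable i)
TCtx : ℕ → Set
TCtx n = Vec MType n

∅ : ∀ {n} → TCtx n
∅ {n} = replicate n []

_⊎_ : ∀ {n} → TCtx n → TCtx n → TCtx n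
_⊎_ = zipWith _++_

single : ∀ {n} → Fin n → LType → TCtx (n)
single zero    L = (L ∷ []) ∷ ∅
single (suc i) L = [] ∷ single i L

mutual
  data _⊢_∶_⟨_,_⟩ {n : ℕ} : TCtx n → Term n → LType → ℕ → ℕ → Set where
    ax     : ∀ (i : Fin n) L → single i L ⊢ var i ∶ L ⟨ 0 , 1 ⟩
    normal : ∀ (t : Term (suc n)) → ∅ ⊢ lam t ∶ normal ⟨ 0 , 0 ⟩
    fun    : ∀ {M Γ t L m e} → (M ∷ Γ) ⊢ t ∶ L ⟨ m , e ⟩ →
             Γ ⊢ lam t ∶ (M ⇒ L) ⟨ m , e ⟩
    app    : ∀ {Γ Π t s M M' L m e m' e'} →
             Γ ⊢ t ∶ (M ⇒ L) ⟨ m , e ⟩ → Π ⊢ₘ s ∶ M' ⟨ m' , e' ⟩ → M ≈M M' →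
             (Γ ⊎ Π) ⊢ app t s ∶ L ⟨ suc (m + m') , e + e' ⟩
    es     : ∀ {Γ Π t s M M' L m e m' e'} →
             (M ∷ Γ) ⊢ t ∶ L ⟨ m , e ⟩ → Π ⊢ₘ s ∶ M' ⟨ m' , e' ⟩ → M ≈M M' →
             (Γ ⊎ Π) ⊢ esub t s ∶ L ⟨ m + m' , e + e' ⟩

  data _⊢ₘ_∶_⟨_,_⟩ {n : ℕ} : TCtx n → Term n → MType → ℕ → ℕ → Set where
    many-[] : ∀ {t} → ∅ ⊢ₘ t ∶ [] ⟨ 0 , 0 ⟩
    many-∷  : ∀ {Π Γ t L M m e m' e'} →
              Π ⊢ t ∶ L ⟨ m , e ⟩ → Γ ⊢ₘ t ∶ M ⟨ m' , e' ⟩ →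
              (Π ⊎ Γ) ⊢ₘ t ∶ (L ∷ M) ⟨ m + m' , e + e' ⟩

Tight : ∀ {n} {Γ : TCtx n} {t : Term n} {L : LType} {m e : ℕ} →
        Γ ⊢ t ∶ L ⟨ m , e ⟩ → Set
Tight {Γ = Γ} {L = L} _ = (L ≡ normal) × (Γ ≡ ∅)
  where open import Relation.Binary.PropositionalEquality using (_≡_)
        open import Data.Product using (_×_)

module Submission where

-- The proof is the usual subject reduction / progress argument, made
-- quantitative.  Multi types are lists up to _≈M_, so we first show that
-- type contexts form a commutative monoid up to pointwise _≈M_, and move
-- to a system ⊢F with a conversion rule, into which the given system
-- embeds and along which multi-type derivations can be retyped.  After
-- weakening, we prove progress (a term is normal, has a CbN redex, or a
-- head variable) and subject reduction: an m-step lowers the index m by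
-- one, an e-step lowers e by one (via linear substitution at the head
-- variable, `head-occurrence`).  Normal forms typed `normal` have indices
-- (0,0), so evaluation by lexicographic induction on (m,e) proves the
-- theorem, tightness ensuring that no index is left over.

open import Defs
open import Data.Nat using (ℕ; _≤_)
open import Data.Vec using ([])
open import Data.Product using (Σ; _×_)
open import Relation.Binary.PropositionalEquality using (_≡_)

open import Level using (0ℓ)
open import Algebra.Bundles using (CommutativeMonoid)
open import Data.Nat using (zero; suc; _+_; z≤n; s≤s)
open import Data.Nat.Properties using (+-assoc; +-commutativeSemigroup)
open import Algebra.Properties.CommutativeSemigroup +-commutativeSemigroup
  using (xy∙z≈xz∙y; x∙yz≈y∙xz)
open import Data.Fin using (Fin; zero; suc; punchIn)
open import Data.List using ([]; _∷_; _++_)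
open import Data.List.Properties using (++-assoc; ++-identityˡ; ++-identityʳ)
open import Data.Vec using (_∷_; insertAt)
open import Data.Vec.Relation.Binary.Pointwise.Inductive as Pointwise
  using (Pointwise; []; _∷_)
open import Data.Product using (_,_; proj₁; map₁; map₂)
open import Relation.Binary.PropositionalEquality
  using (refl; sym; trans; cong; cong₂; subst)
open import Function using (_∘_)

mutual
  reflL : ∀ L → L ≈L L
  reflL normal  = normal≈
  reflL (M ⇒ L) = ⇒≈ (reflM M) (reflL L)

  reflM : ∀ M → M ≈M M
  reflM []       = []≈
  reflM (x ∷ xs) = ∷≈ (reflL x) (reflM xs)

mutual
  symL : ∀ {a b} → a ≈L b → b ≈L a
  symL normal≈  = normal≈
  symL (⇒≈ p q) = ⇒≈ (symM p) (symL q)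

  symM : ∀ {a b} → a ≈M b → b ≈M a
  symM []≈          = []≈
  symM (∷≈ p q)     = ∷≈ (symL p) (symM q)
  symM swap≈        = swap≈
  symM (trans≈ p q) = trans≈ (symM q) (symM p)

transL : ∀ {a b c} → a ≈L b → b ≈L c → a ≈L c
transL normal≈  normal≈    = normal≈
transL (⇒≈ p q) (⇒≈ p' q') = ⇒≈ (trans≈ p p') (transL q q')

≡⇒≈M : ∀ {xs ys} → xs ≡ ys → xs ≈M ys
≡⇒≈M {xs} refl = reflM xs

++-congˡ : ∀ {xs xs'} ys → xs ≈M xs' → (xs ++ ys) ≈M (xs' ++ ys)
++-congˡ ys []≈                 = reflM ys
++-congˡ ys (∷≈ p q)            = ∷≈ p (++-congˡ ys q)
++-congˡ {x ∷ y ∷ xs} ys swap≈ = swap≈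
++-congˡ ys (trans≈ p q)        = trans≈ (++-congˡ ys p) (++-congˡ ys q)

++-congʳ : ∀ xs {ys ys'} → ys ≈M ys' → (xs ++ ys) ≈M (xs ++ ys')
++-congʳ []       q = q
++-congʳ (x ∷ xs) q = ∷≈ (reflL x) (++-congʳ xs q)

++-cong : ∀ {xs xs' ys ys'} → xs ≈M xs' → ys ≈M ys' → (xs ++ ys) ≈M (xs' ++ ys')
++-cong {xs' = xs'} {ys} p q = trans≈ (++-congˡ ys p) (++-congʳ xs' q)

++-cons : ∀ xs y ys → (xs ++ (y ∷ ys)) ≈M (y ∷ (xs ++ ys))
++-cons []       y ys = reflM (y ∷ ys)
++-cons (x ∷ xs) y ys = trans≈ (∷≈ (reflL x) (++-cons xs y ys)) swap≈

++-comm : ∀ xs ys → (xs ++ ys) ≈M (ys ++ xs)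
++-comm []       ys = ≡⇒≈M (sym (++-identityʳ ys))
++-comm (x ∷ xs) ys =
  trans≈ (∷≈ (reflL x) (++-comm xs ys)) (symM (++-cons ys x xs))

_≈C_ : ∀ {n} → TCtx n → TCtx n → Set
Γ ≈C Γ' = Pointwise _≈M_ Γ Γ'

contexts : ℕ → CommutativeMonoid 0ℓ 0ℓ
contexts n = record
  { Carrier             = TCtx n
  ; _≈_                 = _≈C_
  ; _∙_                 = _⊎_
  ; ε                   = ∅
  ; isCommutativeMonoid = record
    { isMonoid = record
      { isSemigroup = record
        { isMagma = record
          { isEquivalence = record
            { refl  = Pointwise.refl (λ {M} → reflM M)
            ; sym   = Pointwise.sym symM
            ; trans = Pointwise.trans trans≈
            }
          ; ∙-cong = Pointwise.zipWith-cong ++-cong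
          }
        ; assoc = Pointwise.zipWith-assoc (λ xs ys zs → ≡⇒≈M (++-assoc xs ys zs))
        }
      ; identity = Pointwise.zipWith-identityˡ (≡⇒≈M ∘ ++-identityˡ)
                 , Pointwise.zipWith-identityʳ (≡⇒≈M ∘ ++-identityʳ)
      }
    ; comm = Pointwise.zipWith-comm ++-comm
    }
  }

module Contexts {n : ℕ} where
  open CommutativeMonoid (contexts n) public
    using (refl; reflexive; sym; trans; ∙-cong; identityˡ; identityʳ; assoc)
  open import Algebra.Properties.CommutativeSemigroup
    (CommutativeMonoid.commutativeSemigroup (contexts n)) public
    using (xy∙z≈xz∙y; x∙yz≈y∙xz)

-- Linear judgements may
-- change their context and type up to ≈; multi-type judgements are the
-- plain (many) rule and are transported along ≈M by `retype` below.

mutual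
  data _⊢F_∶_⟨_,_⟩ {n : ℕ} : TCtx n → Term n → LType → ℕ → ℕ → Set where
    axF     : ∀ (i : Fin n) L → single i L ⊢F var i ∶ L ⟨ 0 , 1 ⟩
    normalF : ∀ (t : Term (suc n)) → ∅ ⊢F lam t ∶ normal ⟨ 0 , 0 ⟩
    funF    : ∀ {M Γ t L m e} → (M ∷ Γ) ⊢F t ∶ L ⟨ m , e ⟩ →
              Γ ⊢F lam t ∶ (M ⇒ L) ⟨ m , e ⟩
    appF    : ∀ {Γ Π t s M L m e m' e'} →
              Γ ⊢F t ∶ (M ⇒ L) ⟨ m , e ⟩ → Π ⊢Fₘ s ∶ M ⟨ m' , e' ⟩ →
              (Γ ⊎ Π) ⊢F app t s ∶ L ⟨ suc (m + m') , e + e' ⟩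
    esF     : ∀ {Γ Π t s M L m e m' e'} →
              (M ∷ Γ) ⊢F t ∶ L ⟨ m , e ⟩ → Π ⊢Fₘ s ∶ M ⟨ m' , e' ⟩ →
              (Γ ⊎ Π) ⊢F esub t s ∶ L ⟨ m + m' , e + e' ⟩
    conv    : ∀ {Γ Γ' t L L' m e} → Γ ≈C Γ' → L ≈L L' →
              Γ ⊢F t ∶ L ⟨ m , e ⟩ → Γ' ⊢F t ∶ L' ⟨ m , e ⟩

  data _⊢Fₘ_∶_⟨_,_⟩ {n : ℕ} : TCtx n → Term n → MType → ℕ → ℕ → Set where
    mnil  : ∀ {t} → ∅ ⊢Fₘ t ∶ [] ⟨ 0 , 0 ⟩
    mcons : ∀ {Π Γ t L M m e m' e'} →
            Π ⊢F t ∶ L ⟨ m , e ⟩ → Γ ⊢Fₘ t ∶ M ⟨ m' , e' ⟩ →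
            (Π ⊎ Γ) ⊢Fₘ t ∶ (L ∷ M) ⟨ m + m' , e + e' ⟩

convΓ : ∀ {n} {Γ Γ' : TCtx n} {t L m e} → Γ ≈C Γ' →
        Γ ⊢F t ∶ L ⟨ m , e ⟩ → Γ' ⊢F t ∶ L ⟨ m , e ⟩
convΓ {L = L} c = conv c (reflL L)

cast : ∀ {n} {Γ : TCtx n} {t L m e m' e'} → m ≡ m' → e ≡ e' →
       Γ ⊢F t ∶ L ⟨ m , e ⟩ → Γ ⊢F t ∶ L ⟨ m' , e' ⟩
cast refl refl D = D

castₘ : ∀ {n} {Γ : TCtx n} {t M m e m' e'} → m ≡ m' → e ≡ e' →
        Γ ⊢Fₘ t ∶ M ⟨ m , e ⟩ → Γ ⊢Fₘ t ∶ M ⟨ m' , e' ⟩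
castₘ refl refl D = D

retype : ∀ {n} {Π : TCtx n} {u M M' m e} → Π ⊢Fₘ u ∶ M ⟨ m , e ⟩ → M ≈M M' →
         Σ (TCtx n) λ Π' → Π' ≈C Π × Π' ⊢Fₘ u ∶ M' ⟨ m , e ⟩
retype mnil []≈ = ∅ , Contexts.refl , mnil
retype (mcons {Π = Πh} D Ds) (∷≈ p q) with retype Ds q
... | Π' , c , Ds' =
  Πh ⊎ Π' , Contexts.∙-cong Contexts.refl c , mcons (conv Contexts.refl p D) Ds'
retype (mcons {Π = Π₁} {m = m₁} {e = e₁} D₁
         (mcons {Π = Π₂} {Γ} {m = m₂} {e = e₂} {m' = m} {e' = e} D₂ Ds)) swap≈ =
  Π₂ ⊎ (Π₁ ⊎ Γ) , Contexts.x∙yz≈y∙xz Π₂ Π₁ Γ ,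
  castₘ (x∙yz≈y∙xz m₂ m₁ m) (x∙yz≈y∙xz e₂ e₁ e) (mcons D₂ (mcons D₁ Ds))
retype Ds (trans≈ p q) with retype Ds p
... | Π' , c , Ds' with retype Ds' q
...   | Π'' , c' , Ds'' = Π'' , Contexts.trans c' c , Ds''

appF≈ : ∀ {n} {Γ Π : TCtx n} {t s M M' L m e m' e'} →
        Γ ⊢F t ∶ (M ⇒ L) ⟨ m , e ⟩ → Π ⊢Fₘ s ∶ M' ⟨ m' , e' ⟩ → M ≈M M' →
        (Γ ⊎ Π) ⊢F app t s ∶ L ⟨ suc (m + m') , e + e' ⟩
appF≈ D Ds p with retype Ds (symM p)
... | _ , c , Ds' = convΓ (Contexts.∙-cong Contexts.refl c) (appF D Ds')

esF≈ : ∀ {n} {Γ Π : TCtx n} {t s M M' L m e m' e'} →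
       (M ∷ Γ) ⊢F t ∶ L ⟨ m , e ⟩ → Π ⊢Fₘ s ∶ M' ⟨ m' , e' ⟩ → M ≈M M' →
       (Γ ⊎ Π) ⊢F esub t s ∶ L ⟨ m + m' , e + e' ⟩
esF≈ D Ds p with retype Ds (symM p)
... | _ , c , Ds' = convΓ (Contexts.∙-cong Contexts.refl c) (esF D Ds')

mutual
  embed : ∀ {n} {Γ : TCtx n} {t L m e} → Γ ⊢ t ∶ L ⟨ m , e ⟩ → Γ ⊢F t ∶ L ⟨ m , e ⟩
  embed (ax i L)      = axF i L
  embed (normal t)    = normalF t
  embed (fun D)       = funF (embed D)
  embed (app D Ds p)  = appF≈ (embed D) (embedₘ Ds) p
  embed (es D Ds p)   = esF≈ (embed D) (embedₘ Ds) p

  embedₘ : ∀ {n} {Γ : TCtx n} {t M m e} → Γ ⊢ₘ t ∶ M ⟨ m , e ⟩ → Γ ⊢Fₘ t ∶ M ⟨ m , e ⟩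
  embedₘ many-[]       = mnil
  embedₘ (many-∷ D Ds) = mcons (embed D) (embedₘ Ds)

ext-cong : ∀ {n k} {f g : Fin n → Fin k} → (∀ i → f i ≡ g i) → ∀ i → ext f i ≡ ext g i
ext-cong h zero    = refl
ext-cong h (suc i) = cong suc (h i)

rename-cong : ∀ {n k} {f g : Fin n → Fin k} → (∀ i → f i ≡ g i) →
              ∀ t → rename f t ≡ rename g t
rename-cong h (var i)    = cong var (h i)
rename-cong h (lam t)    = cong lam (rename-cong (ext-cong h) t)
rename-cong h (app t s)  = cong₂ app (rename-cong h t) (rename-cong h s)
rename-cong h (esub t s) = cong₂ esub (rename-cong (ext-cong h) t) (rename-cong h s)

ext-id : ∀ {n} {f : Fin n → Fin n} → (∀ i → f i ≡ i) → ∀ i → ext f i ≡ i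
ext-id h zero    = refl
ext-id h (suc i) = cong suc (h i)

rename-id : ∀ {n} {f : Fin n → Fin n} → (∀ i → f i ≡ i) → ∀ t → rename f t ≡ t
rename-id h (var i)    = cong var (h i)
rename-id h (lam t)    = cong lam (rename-id (ext-id h) t)
rename-id h (app t s)  = cong₂ app (rename-id h t) (rename-id h s)
rename-id h (esub t s) = cong₂ esub (rename-id (ext-id h) t) (rename-id h s)

ext-∘ : ∀ {a b c} (f : Fin b → Fin c) (g : Fin a → Fin b) →
        ∀ i → ext f (ext g i) ≡ ext (f ∘ g) i
ext-∘ f g zero    = refl
ext-∘ f g (suc i) = refl

rename-∘ : ∀ {a b c} (f : Fin b → Fin c) (g : Fin a → Fin b) →
           ∀ t → rename f (rename g t) ≡ rename (f ∘ g) t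
rename-∘ f g (var i)    = refl
rename-∘ f g (lam t)    =
  cong lam (trans (rename-∘ (ext f) (ext g) t) (rename-cong (ext-∘ f g) t))
rename-∘ f g (app t s)  = cong₂ app (rename-∘ f g t) (rename-∘ f g s)
rename-∘ f g (esub t s) =
  cong₂ esub (trans (rename-∘ (ext f) (ext g) t) (rename-cong (ext-∘ f g) t))
             (rename-∘ f g s)

ext-punchIn : ∀ {n} (i : Fin (suc n)) → ∀ j → punchIn (suc i) j ≡ ext (punchIn i) j
ext-punchIn i zero    = refl
ext-punchIn i (suc j) = refl

insertAt-∅ : ∀ {n} (i : Fin (suc n)) → insertAt ∅ i [] ≡ ∅
insertAt-∅ zero            = refl
insertAt-∅ {suc n} (suc i) = cong ([] ∷_) (insertAt-∅ i)

insertAt-⊎ : ∀ {n} (i : Fin (suc n)) (Γ Π : TCtx n) →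
             insertAt (Γ ⊎ Π) i [] ≡ (insertAt Γ i [] ⊎ insertAt Π i [])
insertAt-⊎ zero    Γ       Π       = refl
insertAt-⊎ (suc i) (M ∷ Γ) (N ∷ Π) = cong ((M ++ N) ∷_) (insertAt-⊎ i Γ Π)

insertAt-single : ∀ {n} (i : Fin (suc n)) (j : Fin n) L →
                  insertAt (single j L) i [] ≡ single (punchIn i j) L
insertAt-single zero    j       L = refl
insertAt-single (suc i) zero    L = cong ((L ∷ []) ∷_) (insertAt-∅ i)
insertAt-single (suc i) (suc j) L = cong ([] ∷_) (insertAt-single i j L)

insertAt-≈ : ∀ {n} (i : Fin (suc n)) {Γ Γ' : TCtx n} → Γ ≈C Γ' →
             insertAt Γ i [] ≈C insertAt Γ' i []
insertAt-≈ zero    c       = []≈ ∷ c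
insertAt-≈ (suc i) (p ∷ c) = p ∷ insertAt-≈ i c

mutual
  weaken : ∀ {n} (i : Fin (suc n)) {Γ t L m e} → Γ ⊢F t ∶ L ⟨ m , e ⟩ →
           insertAt Γ i [] ⊢F rename (punchIn i) t ∶ L ⟨ m , e ⟩
  weaken i (axF j L)   =
    convΓ (Contexts.reflexive (sym (insertAt-single i j L))) (axF (punchIn i j) L)
  weaken i (normalF t) = convΓ (Contexts.reflexive (sym (insertAt-∅ i))) (normalF _)
  weaken i (funF {t = t} D) = funF (weaken-body i t D)
  weaken i (appF {Γ = Γ} {Π} D Ds) =
    convΓ (Contexts.reflexive (sym (insertAt-⊎ i Γ Π))) (appF (weaken i D) (weakenₘ i Ds))
  weaken i (esF {Γ = Γ} {Π} {t} D Ds) =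
    convΓ (Contexts.reflexive (sym (insertAt-⊎ i Γ Π)))
      (esF (weaken-body i t D) (weakenₘ i Ds))
  weaken i (conv c p D) = conv (insertAt-≈ i c) p (weaken i D)

  weaken-body : ∀ {n} (i : Fin (suc n)) (t : Term (suc n)) {M Γ L m e} →
                (M ∷ Γ) ⊢F t ∶ L ⟨ m , e ⟩ →
                (M ∷ insertAt Γ i []) ⊢F rename (ext (punchIn i)) t ∶ L ⟨ m , e ⟩
  weaken-body i t D =
    subst (λ u → _ ⊢F u ∶ _ ⟨ _ , _ ⟩) (rename-cong (ext-punchIn i) t) (weaken (suc i) D)

  weakenₘ : ∀ {n} (i : Fin (suc n)) {Γ t M m e} → Γ ⊢Fₘ t ∶ M ⟨ m , e ⟩ →
            insertAt Γ i [] ⊢Fₘ rename (punchIn i) t ∶ M ⟨ m , e ⟩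
  weakenₘ i {t = t} mnil =
    subst (λ Γ → Γ ⊢Fₘ rename (punchIn i) t ∶ [] ⟨ 0 , 0 ⟩) (sym (insertAt-∅ i)) mnil
  weakenₘ i (mcons {Π = Π} {Γ} D Ds) =
    subst (λ Δ → Δ ⊢Fₘ _ ∶ _ ⟨ _ , _ ⟩) (sym (insertAt-⊎ i Π Γ))
      (mcons (weaken i D) (weakenₘ i Ds))

normal-shape : ∀ {n} {t : Term n} → Normal t →
               Σ ℕ λ k → Σ (SCtx n k) λ S → Σ (Term (suc k)) λ b → t ≡ plugS S (lam b)
normal-shape (normal-lam {t = b}) = _ , hole , b , refl
normal-shape (normal-es {s = s} nt) with normal-shape nt
... | k , S , b , refl = k , esL S s , b , refl

data Progress {n} (t : Term n) : Set where
  isNormal : Normal t → Progress t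
  redex-m  : ∀ {k} (C : Ctx n k) {r r' : Term k} → r ↦m r' → t ≡ plug C r → Progress t
  redex-e  : ∀ {k} (C : Ctx n k) {r r' : Term k} → r ↦e r' → t ≡ plug C r → Progress t
  headVar  : ∀ {k} (C : Ctx n k) (i : Fin n) → t ≡ plug C (var (wkC C i)) → Progress t

progress : ∀ {n} (t : Term n) → Progress t
progress (var i)    = headVar hole i refl
progress (lam t)    = isNormal normal-lam
progress (app t u) with progress t
... | isNormal nt with normal-shape nt
...   | k , S , b , refl  = redex-m hole (rule-m S b u) refl
progress (app t u) | redex-m C p refl  = redex-m (appL C u) p refl
progress (app t u) | redex-e C p refl  = redex-e (appL C u) p refl
progress (app t u) | headVar C i refl  = headVar (appL C u) i refl
progress (esub t u) with progress t
... | isNormal nt             = isNormal (normal-es nt)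
... | redex-m C p refl        = redex-m (esL C u) p refl
... | redex-e C p refl        = redex-e (esL C u) p refl
... | headVar C zero refl     = redex-e hole (rule-e C u) refl
... | headVar C (suc j) refl  = headVar (esL C u) j refl

m-reduct : ∀ {n k} (S : SCtx n k) {t : Term (suc k)} {s : Term n} {Γ Π M L m₁ e₁ m₂ e₂} →
           Γ ⊢F plugS S (lam t) ∶ (M ⇒ L) ⟨ m₁ , e₁ ⟩ → Π ⊢Fₘ s ∶ M ⟨ m₂ , e₂ ⟩ →
           (Γ ⊎ Π) ⊢F plugS S (esub t (rename (wkS S) s)) ∶ L ⟨ m₁ + m₂ , e₁ + e₂ ⟩
m-reduct hole {s = s} (funF D) Ds =
  esF D (subst (λ u → _ ⊢Fₘ u ∶ _ ⟨ _ , _ ⟩) (sym (rename-id (λ _ → refl) s)) Ds)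
m-reduct S (conv c (⇒≈ p q) D) Ds with retype Ds (symM p)
... | _ , c' , Ds' = conv (Contexts.∙-cong c c') q (m-reduct S D Ds')
m-reduct (esL S u) {t} {s} {Π = Π} {L = L} {m₂ = m₂} {e₂ = e₂}
  (esF {Γ = Γ} {Π = Πu} {M = Mu} {m = m} {e = e} {m' = mu} {e' = eu} D Du) Ds =
  conv (Contexts.xy∙z≈xz∙y Γ Π Πu) (reflL L)
    (cast (xy∙z≈xz∙y m m₂ mu) (xy∙z≈xz∙y e e₂ eu) (esF D' Du))
  where
    -- the induction hypothesis for S, with s weakened under the binder of u
    D' : (Mu ∷ (Γ ⊎ Π)) ⊢F plugS S (esub t (rename (wkS S ∘ suc) s)) ∶ L ⟨ m + m₂ , e + e₂ ⟩
    D' = conv (≡⇒≈M (++-identityʳ Mu) ∷ Contexts.refl) (reflL L)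
           (subst (λ v → _ ⊢F plugS S (esub t v) ∶ L ⟨ _ , _ ⟩) (rename-∘ (wkS S) suc s)
             (m-reduct S D (weakenₘ zero Ds)))

root-m : ∀ {n} {r r' : Term n} → r ↦m r' → ∀ {Γ L m e} → Γ ⊢F r ∶ L ⟨ m , e ⟩ →
         Σ ℕ λ m' → (m ≡ suc m') × Γ ⊢F r' ∶ L ⟨ m' , e ⟩
root-m (rule-m S t s) (appF D Ds) = _ , refl , m-reduct S D Ds
root-m p (conv c q D) with root-m p D
... | m' , refl , D' = m' , refl , conv c q D'

reduction-m : ∀ {n k} (C : Ctx n k) {r r' : Term k} → r ↦m r' → ∀ {Γ L m e} →
              Γ ⊢F plug C r ∶ L ⟨ m , e ⟩ →
              Σ ℕ λ m' → (m ≡ suc m') × Γ ⊢F plug C r' ∶ L ⟨ m' , e ⟩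
reduction-m hole       p D = root-m p D
reduction-m C          p (conv c q D) with reduction-m C p D
... | m' , refl , D' = m' , refl , conv c q D'
reduction-m (appL C u) p (appF D Du) with reduction-m C p D
... | m' , refl , D' = _ , refl , appF D' Du
reduction-m (esL C u)  p (esF D Du) with reduction-m C p D
... | m' , refl , D' = _ , refl , esF D' Du

-- In a derivation for C⟨⟨x_i⟩⟩ the head occurrence of x_i consumes one
-- linear type Lx of i and one exponential unit; replacing it by any term
-- w typed with Lx yields a derivation whose indices add up (linear
-- substitution at the head).
record HeadOccurrence {n k} (C : Ctx n k) (i : Fin n) (w : Term n)
                      (Δ : TCtx n) (L : LType) (m e : ℕ) : Set where
  constructor headOccurrence
  field
    Lx      : LType
    Δrest   : TCtx n
    e-1     : ℕ
    e≡      : e ≡ suc e-1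
    split   : Δ ≈C (Δrest ⊎ single i Lx)
    replace : ∀ {Θ mw ew} → Θ ⊢F w ∶ Lx ⟨ mw , ew ⟩ →
              (Δrest ⊎ Θ) ⊢F plug C (rename (wkC C) w) ∶ L ⟨ m + mw , e-1 + ew ⟩

head-occurrence : ∀ {n k} (C : Ctx n k) (i : Fin n) (w : Term n) {Δ L m e} →
                  Δ ⊢F plug C (var (wkC C i)) ∶ L ⟨ m , e ⟩ → HeadOccurrence C i w Δ L m e
head-occurrence hole i w (axF .i L) =
  headOccurrence L ∅ 0 refl (Contexts.sym (Contexts.identityˡ (single i L)))
    (λ {Θ} Dw → convΓ (Contexts.sym (Contexts.identityˡ Θ))
                  (subst (λ v → Θ ⊢F v ∶ L ⟨ _ , _ ⟩) (sym (rename-id (λ _ → refl) w)) Dw))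
head-occurrence C i w (conv c q D) with head-occurrence C i w D
... | headOccurrence Lx Δr e' eq c' f =
  headOccurrence Lx Δr e' eq (Contexts.trans (Contexts.sym c) c') (conv Contexts.refl q ∘ f)
head-occurrence (appL C v) i w {L = L}
  (appF {Π = Π} {m = m₁} {m' = m₂} {e' = e₂} D Dv) with head-occurrence C i w D
... | headOccurrence Lx Γr e₁ refl c f =
  headOccurrence Lx (Γr ⊎ Π) (e₁ + e₂) refl
    (Contexts.trans (Contexts.∙-cong c Contexts.refl) (Contexts.xy∙z≈xz∙y Γr (single i Lx) Π))
    (λ {Θ} {mw} {ew} Dw → convΓ (Contexts.xy∙z≈xz∙y Γr Θ Π)
       (cast (cong suc (xy∙z≈xz∙y m₁ mw m₂)) (xy∙z≈xz∙y e₁ ew e₂) (appF (f Dw) Dv)))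
head-occurrence (esL C v) i w {L = L}
  (esF {Π = Π} {M = M} {m = m₁} {m' = m₂} {e' = e₂} D Dv)
  with head-occurrence C (suc i) (rename suc w) D
... | headOccurrence Lx (Mr ∷ Γr) e₁ refl (cM ∷ c) f =
  headOccurrence Lx (Γr ⊎ Π) (e₁ + e₂) refl
    (Contexts.trans (Contexts.∙-cong c Contexts.refl) (Contexts.xy∙z≈xz∙y Γr (single i Lx) Π))
    (λ {Θ} {mw} {ew} Dw → convΓ (Contexts.xy∙z≈xz∙y Γr Θ Π)
       (cast (xy∙z≈xz∙y m₁ mw m₂) (xy∙z≈xz∙y e₁ ew e₂) (esF (body Dw) Dv)))
  where
    body : ∀ {Θ mw ew} → Θ ⊢F w ∶ Lx ⟨ mw , ew ⟩ →
           (M ∷ (Γr ⊎ Θ)) ⊢F plug C (rename (wkC C ∘ suc) w) ∶ L ⟨ m₁ + mw , e₁ + ew ⟩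
    body Dw = convΓ (symM cM ∷ Contexts.refl)
      (subst (λ x → _ ⊢F plug C x ∶ L ⟨ _ , _ ⟩) (rename-∘ (wkC C) suc w)
        (f (weaken zero Dw)))

-- subject reduction at the root: the argument u of the substitution is
-- split into the copy typed with Lx and the rest of its multi type
root-e : ∀ {n} {r r' : Term n} → r ↦e r' → ∀ {Γ L m e} → Γ ⊢F r ∶ L ⟨ m , e ⟩ →
         Σ ℕ λ e' → (e ≡ suc e') × Γ ⊢F r' ∶ L ⟨ m , e' ⟩
root-e p (conv c q D) with root-e p D
... | e' , refl , D' = e' , refl , conv c q D'
root-e (rule-e C u) {L = L} (esF {Γ = Γ} {Π = Π} {m = m₁} D Du)
  with head-occurrence C zero (rename suc u) D
... | headOccurrence Lx (Mr ∷ Γr) e₁ refl (cM ∷ cΓ) f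
  with retype Du (trans≈ cM (++-comm Mr (Lx ∷ [])))
...   | _ , cΠ , mcons {Π = Π₁} {Γ = Π₂} {m = a} {e = b} {m' = c} {e' = d} Dx Drest =
  e₁ + (b + d) , refl ,
  convΓ split (cast (+-assoc m₁ a c) (+-assoc e₁ b d) (esF copied Drest))
  where
    copied : (Mr ∷ (Γr ⊎ Π₁)) ⊢F plug C (rename (wkC C ∘ suc) u) ∶ L ⟨ m₁ + a , e₁ + b ⟩
    copied = convΓ (≡⇒≈M (++-identityʳ Mr) ∷ Contexts.refl)
      (subst (λ x → _ ⊢F plug C x ∶ L ⟨ _ , _ ⟩) (rename-∘ (wkC C) suc u)
        (f (weaken zero Dx)))

    split : ((Γr ⊎ Π₁) ⊎ Π₂) ≈C (Γ ⊎ Π)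
    split = Contexts.trans (Contexts.assoc Γr Π₁ Π₂)
      (Contexts.∙-cong (Contexts.sym (Contexts.trans cΓ (Contexts.identityʳ Γr))) cΠ)

reduction-e : ∀ {n k} (C : Ctx n k) {r r' : Term k} → r ↦e r' → ∀ {Γ L m e} →
              Γ ⊢F plug C r ∶ L ⟨ m , e ⟩ →
              Σ ℕ λ e' → (e ≡ suc e') × Γ ⊢F plug C r' ∶ L ⟨ m , e' ⟩
reduction-e hole       p D = root-e p D
reduction-e C          p (conv c q D) with reduction-e C p D
... | e' , refl , D' = e' , refl , conv c q D'
reduction-e (appL C u) p (appF D Du) with reduction-e C p D
... | e' , refl , D' = _ , refl , appF D' Du
reduction-e (esL C u)  p (esF D Du) with reduction-e C p D
... | e' , refl , D' = _ , refl , esF D' Du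

empty-multi : ∀ {n} {Π : TCtx n} {u M m e} → Π ⊢Fₘ u ∶ M ⟨ m , e ⟩ → M ≈M [] →
              (m ≡ 0) × (e ≡ 0) × (Π ≈C ∅)
empty-multi Ds p with retype Ds p
... | _ , c , mnil = refl , refl , Contexts.sym c

normal-free : ∀ {n} {Γ : TCtx n} {t L m e} → Normal t → Γ ⊢F t ∶ L ⟨ m , e ⟩ →
              L ≈L normal → (m ≡ 0) × (e ≡ 0) × (Γ ≈C ∅)
normal-free nt (conv c q D) r with normal-free nt D (transL q r)
... | refl , refl , c' = refl , refl , Contexts.trans (Contexts.sym c) c'
normal-free normal-lam (normalF _) r = refl , refl , Contexts.refl
normal-free normal-lam (funF D) ()
normal-free (normal-es nt) (esF D Ds) r with normal-free nt D r
... | refl , refl , (cM ∷ cΓ) with empty-multi Ds cM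
...   | refl , refl , cΠ =
  refl , refl , Contexts.trans (Contexts.∙-cong cΓ cΠ) (Contexts.identityˡ ∅)

-- the conclusion of the theorem; for closed terms tightness only
-- requires the type to be `normal`
Evaluation : Term 0 → LType → ℕ → ℕ → Set
Evaluation t L m e = Σ (Term 0) λ s → Σ (t ⟶* s) λ d →
  Normal s × ∣ d ∣m ≤ m × ∣ d ∣e ≤ e × (L ≡ normal → (∣ d ∣m ≡ m × ∣ d ∣e ≡ e))

m-then : ∀ {k} (C : Ctx 0 k) {r r' : Term k} → r ↦m r' → ∀ {L m e} →
         Evaluation (plug C r') L m e → Evaluation (plug C r) L (suc m) e
m-then C p (s , d , ns , bm , be , exact) =
  s , m-step C p ∷ d , ns , s≤s bm , be , map₁ (cong suc) ∘ exact

e-then : ∀ {k} (C : Ctx 0 k) {r r' : Term k} → r ↦e r' → ∀ {L m e} →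
         Evaluation (plug C r') L m e → Evaluation (plug C r) L m (suc e)
e-then C p (s , d , ns , bm , be , exact) =
  s , e-step C p ∷ d , ns , bm , s≤s be , map₂ (cong suc) ∘ exact

-- by lexicographic induction on (m , e): each step lowers one index
evaluate : ∀ {t L} m e → [] ⊢F t ∶ L ⟨ m , e ⟩ → Evaluation t L m e
evaluate {t} {L} m e D with progress t
... | isNormal nt = t , done , nt , z≤n , z≤n , exact
  where
    exact : L ≡ normal → (0 ≡ m × 0 ≡ e)
    exact refl with normal-free nt D normal≈
    ... | refl , refl , _ = refl , refl
... | headVar C () _
... | redex-m C p refl with reduction-m C p D
...   | m' , refl , D' = m-then C p (evaluate m' e D')
evaluate m e D | redex-e C p refl with reduction-e C p D
...   | e' , refl , D' = e-then C p (evaluate m e' D')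

theorem1 : (t : Term 0) (m e : ℕ) (L : LType) (Φ : [] ⊢ t ∶ L ⟨ m , e ⟩) →
    Σ (Term 0) (λ s → Σ (t ⟶* s) (λ d →
    Normal s × ∣ d ∣m ≤ m × ∣ d ∣e ≤ e ×
    (Tight Φ → (∣ d ∣m ≡ m × ∣ d ∣e ≡ e))))
theorem1 t m e L Φ with evaluate m e (embed Φ)
... | s , d , ns , bm , be , exact = s , d , ns , bm , be , exact ∘ proj₁
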